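{- Fix $k \ge 3$. For all $n \ge k-1$, $$|S_n(132, 213, 23\ldots k\,1)| = 1 + \sum_{i=1}^{k-2} |S_{n-i}(132, 213, 23\ldots k\,1)|.$$
   Context: Permutations of $[n]$ are written in one-line notation, and $S_n$ denotes the set of them. A permutation $\pi\in S_n$ contains $\sigma\in S_m$ if there are indices $i_1<\dots<i_m$ such that for all $a,b$, $\pi(i_a)<\pi(i_b)$ iff $\sigma(a)<\sigma(b)$; otherwise $\pi$ avoids $\sigma$. For a set $R$ of permutations, $S_n(R)$ is the set of $\pi\in S_n$ avoiding every element of $R$; $S_0(R)$ consists of the empty permutation only. The permutation $23\ldots k\,1\in S_k$ is $2,3,\dots,k$ followed by $1$. -}

module Defs where

open import Data.Nat using (ℕ; zero; suc; _+_; _∸_; _<_; _≟_)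
open import Data.Fin using (Fin; toℕ) renaming (_<_ to _<ᶠ_)
open import Data.Vec using (Vec; lookup)
open import Data.List using (List; length)
open import Data.List.Relation.Unary.Unique.Propositional using (Unique)
open import Data.List.Membership.Propositional using (_∈_)
open import Data.Product using (Σ; _×_; ∃)
open import Relation.Binary.PropositionalEquality using (_≡_)
open import Relation.Nullary using (¬_; yes; no)
open import Function.Bundles using (_⇔_)

-- A word of length n over [n] = {0,..,n-1} (0-based values), i.e. a candidate
-- permutation in one-line notation: position i ↦ lookup w i.
Word : ℕ → Set
Word n = Vec (Fin n) n

-- w is a permutation of [n]: its one-line notation is injective
-- (an injective map Fin n → Fin n is a bijection).
IsPerm : ∀ {n} → Word n → Set
IsPerm {n} w = ∀ (i j : Fin n) → lookup w i ≡ lookup w j → i ≡ j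

-- A pattern of length m is given by its one-line notation as values in ℕ;
-- only the relative order of the values matters.
Pattern : ℕ → Set
Pattern m = Fin m → ℕ

Contains : ∀ {n m} → Word n → Pattern m → Set
Contains {n} {m} w σ =
  Σ (Fin m → Fin n) λ f →
    (∀ a b → a <ᶠ b → f a <ᶠ f b) ×
    (∀ a b → (toℕ (lookup w (f a)) < toℕ (lookup w (f b))) ⇔ (σ a < σ b))

Avoids : ∀ {n m} → Word n → Pattern m → Set
Avoids w σ = ¬ Contains w σ

p132 : Pattern 3
p132 Fin.zero = 1
p132 (Fin.suc Fin.zero) = 3
p132 (Fin.suc (Fin.suc Fin.zero)) = 2

p213 : Pattern 3
p213 Fin.zero = 2
p213 (Fin.suc Fin.zero) = 1
p213 (Fin.suc (Fin.suc Fin.zero)) = 3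

pCyc : (k : ℕ) → Pattern k
pCyc k a with suc (toℕ a) ≟ k
... | yes _ = 1
... | no _ = suc (suc (toℕ a))

InS : (k n : ℕ) → Word n → Set
InS k n w = IsPerm w × Avoids w p132 × Avoids w p213 × Avoids w (pCyc k)

IsCount : (k n c : ℕ) → Set
IsCount k n c =
  Σ (List (Word n)) λ L →
    length L ≡ c × Unique L × (∀ (w : Word n) → (w ∈ L) ⇔ InS k n w)

sumFrom1 : ℕ → (ℕ → ℕ) → ℕ
sumFrom1 zero f = 0
sumFrom1 (suc m) f = sumFrom1 m f + f (suc m)

-- A permutation avoiding 132 and 213 whose first entry is v begins with the run
-- v, v + 1, …, n - 1 of its largest values: the entry v + t cannot sit right of position t
-- without creating a 213 or a 132.  Hence such permutations are exactly the words
-- "increasing run of the i ≥ 1 largest values, followed by a smaller permutation u" with u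
-- again avoiding 132 and 213.  Such a word contains 23…k1 iff u does, or the run has length
-- between k - 1 and n - 1 (its first k - 1 entries and the first entry of u form one).
-- Sorting S_n(132, 213, 23…k1) by the run length gives the identity (i = n) together with a
-- copy of S_{n-i} for each 1 ≤ i ≤ k - 2, and these are disjoint once n ≥ k - 1.

module Submission where

open import Defs
open import Data.Empty using (⊥; ⊥-elim)
open import Data.Fin using (Fin; toℕ; fromℕ; fromℕ<; inject₁; inject≤; punchOut)
  renaming (zero to fzero; suc to fsuc; _<_ to _<ᶠ_)
open import Data.Fin.Induction using (<-wellFounded)
open import Data.Fin.Properties
  using (toℕ<n; toℕ-injective; toℕ-fromℕ; toℕ-fromℕ<; toℕ-inject₁; toℕ-inject≤; ¬Fin0;
         any?; all?; punchOut-injective; injective⇒≤)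
  renaming (_≟_ to _≟ᶠ_)
open import Data.List using (List; []; _∷_; [_]; length; _++_; map)
open import Data.List.Membership.Propositional using (_∈_)
open import Data.List.Membership.Propositional.Properties using (++-∈⇔; ∈-map⁺; ∈-map⁻)
open import Data.List.Membership.Propositional.Properties.WithK using (unique∧set⇒bag)
open import Data.List.Properties using (length-++; length-map)
open import Data.List.Relation.Binary.BagAndSetEquality using (∼bag⇒↭)
open import Data.List.Relation.Binary.Permutation.Propositional.Properties using (↭-length)
open import Data.List.Relation.Unary.All using ([])
open import Data.List.Relation.Unary.AllPairs using ([]; _∷_)
open import Data.List.Relation.Unary.Any using (here; there)
open import Data.List.Relation.Unary.Unique.Propositional using (Unique)
open import Data.List.Relation.Unary.Unique.Propositional.Properties using (++⁺; map⁺)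
open import Data.Nat using (ℕ; zero; suc; _+_; _∸_; _≤_; _<_; z≤n; s≤s; _≟_; _<?_; _≤?_)
open import Data.Nat.Properties
open import Data.Product using (_×_; _,_; ∃; proj₁; proj₂)
open import Data.Sum using (_⊎_; inj₁; inj₂)
open import Data.Sum.Function.Propositional using (_⊎-⇔_)
open import Data.Vec using ([]; lookup; tabulate)
open import Data.Vec.Properties using (lookup∘tabulate; tabulate∘lookup; tabulate-cong)
open import Function.Base using (_∘_)
open import Function.Bundles using (_⇔_; mk⇔; Equivalence)
open import Function.Construct.Composition using (_⇔-∘_)
open import Function.Construct.Symmetry using (⇔-sym)
open import Induction.WellFounded using (module All)
open import Relation.Binary.Definitions using (Tri; tri<; tri≈; tri>)
open import Relation.Binary.PropositionalEquality
  using (_≡_; _≢_; refl; sym; trans; cong; cong₂; subst; subst₂; module ≡-Reasoning)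
open import Relation.Nullary using (¬_; Dec; yes; no; contradiction)
open import Relation.Nullary.Decidable using (_→-dec_; toWitness)

open Equivalence using (to; from)

private variable
  A B : Set
  P Q : A → Set
  L L₁ L₂ : List A
  m n n′ : ℕ

-- Enumerations by duplicate-free lists

Enumerates : (A → Set) → List A → Set
Enumerates P L = Unique L × (∀ x → x ∈ L ⇔ P x)

enumerates-length : Enumerates P L₁ → Enumerates P L₂ → length L₁ ≡ length L₂
enumerates-length (u₁ , e₁) (u₂ , e₂) =
  ↭-length (∼bag⇒↭ (unique∧set⇒bag u₁ u₂ (⇔-sym (e₂ _) ⇔-∘ e₁ _)))

enumerates-cong : (∀ x → P x ⇔ Q x) → Enumerates P L → Enumerates Q L
enumerates-cong P⇔Q (u , e) = u , λ x → P⇔Q x ⇔-∘ e x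

enumerates-[_] : (x : A) → Enumerates (_≡ x) [ x ]
enumerates-[ x ] = [] ∷ [] , λ y → mk⇔ (λ { (here y≡x) → y≡x ; (there ()) }) here

enumerates-++ : Enumerates P L₁ → Enumerates Q L₂ → (∀ x → P x → ¬ Q x) →
                Enumerates (λ x → P x ⊎ Q x) (L₁ ++ L₂)
enumerates-++ (u₁ , e₁) (u₂ , e₂) disjoint =
  ++⁺ u₁ u₂ (λ (x∈L₁ , x∈L₂) → disjoint _ (to (e₁ _) x∈L₁) (to (e₂ _) x∈L₂)) ,
  λ x → (e₁ x ⊎-⇔ e₂ x) ⇔-∘ ++-∈⇔

enumerates-map : (g : A → B) → (∀ {x y} → g x ≡ g y → x ≡ y) → Enumerates P L →
                 Enumerates (λ y → ∃ λ x → P x × g x ≡ y) (map g L)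
enumerates-map g g-injective (u , e) =
  map⁺ g-injective u ,
  λ y → mk⇔ (λ y∈ → let x , x∈L , y≡gx = ∈-map⁻ g y∈ in x , to (e x) x∈L , sym y≡gx)
            (λ { (x , Px , refl) → ∈-map⁺ g (from (e x) Px) })

-- Words and pattern occurrences

value : Word n → Fin n → ℕ
value w t = toℕ (lookup w t)

word-ext : {w w′ : Word n} → (∀ j → value w j ≡ value w′ j) → w ≡ w′
word-ext {w = w} {w′} same = begin
  w                    ≡⟨ tabulate∘lookup w ⟨
  tabulate (lookup w)  ≡⟨ tabulate-cong (λ j → toℕ-injective (same j)) ⟩
  tabulate (lookup w′) ≡⟨ tabulate∘lookup w′ ⟩
  w′                   ∎
  where open ≡-Reasoning

value-injective : (w : Word n) → IsPerm w → ∀ a b → value w a ≡ value w b → a ≡ b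
value-injective w w-perm a b eq = w-perm a b (toℕ-injective eq)

-- If y were missed, punching it out would inject Fin (suc n) into Fin n.
IsPerm-surjective : (w : Word n) → IsPerm w → ∀ y → ∃ λ p → lookup w p ≡ y
IsPerm-surjective {suc n} w w-perm y with any? (λ p → lookup w p ≟ᶠ y)
... | yes hit = hit
... | no  miss = ⊥-elim (<-irrefl refl (injective⇒≤ missing-y-injective))
  where
  missing-y : Fin (suc n) → Fin n
  missing-y p = punchOut {i = y} {j = lookup w p} (λ y≡ → miss (p , sym y≡))
  missing-y-injective : ∀ {a b} → missing-y a ≡ missing-y b → a ≡ b
  missing-y-injective {a} {b} eq =
    w-perm a b (punchOut-injective (λ y≡ → miss (a , sym y≡)) (λ y≡ → miss (b , sym y≡)) eq)

Increasing : (Fin m → Fin n) → Set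
Increasing f = ∀ a b → a <ᶠ b → f a <ᶠ f b

increasing-spread : {f : Fin (suc m) → Fin n} → Increasing f →
                    ∀ a → toℕ a + toℕ (f fzero) ≤ toℕ (f a)
increasing-spread inc fzero = ≤-refl
increasing-spread {suc m} {f = f} inc (fsuc a) = begin
  suc (toℕ a + toℕ (f fzero)) ≡⟨ +-suc (toℕ a) _ ⟨
  toℕ a + suc (toℕ (f fzero)) ≤⟨ +-monoʳ-≤ (toℕ a) (inc fzero (fsuc fzero) (s≤s z≤n)) ⟩
  toℕ a + toℕ (f (fsuc fzero)) ≤⟨ increasing-spread (λ a b a<b → inc (fsuc a) (fsuc b) (s≤s a<b)) a ⟩
  toℕ (f (fsuc a))            ∎
  where open ≤-Reasoning

increasing⇒≥id : {f : Fin m → Fin n} → Increasing f → ∀ a → toℕ a ≤ toℕ (f a)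
increasing⇒≥id {suc m} inc a = ≤-trans (m≤m+n (toℕ a) _) (increasing-spread inc a)

increasing-least : {f : Fin (suc m) → Fin n} → Increasing f → ∀ a → toℕ (f fzero) ≤ toℕ (f a)
increasing-least inc a = ≤-trans (m≤n+m _ (toℕ a)) (increasing-spread inc a)

PatternInjective : Pattern m → Set
PatternInjective σ = ∀ a b → σ a ≡ σ b → a ≡ b

contains-< : (w : Word n) {σ : Pattern m} (c : Contains w σ) →
             ∀ a b → σ a < σ b → value w (proj₁ c a) < value w (proj₁ c b)
contains-< w (_ , _ , same-order) a b = from (same-order a b)

contains-by-order : (w : Word n) {σ : Pattern m} → PatternInjective σ →
                    (f : Fin m → Fin n) → Increasing f →
                    (∀ a b → σ a < σ b → value w (f a) < value w (f b)) → Contains w σ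
contains-by-order w {σ} σ-injective f inc preserves = f , inc , λ a b → mk⇔ (reflects a b) (preserves a b)
  where
  reflects : ∀ a b → value w (f a) < value w (f b) → σ a < σ b
  reflects a b lt with <-cmp (σ a) (σ b)
  ... | tri< σa<σb _ _ = σa<σb
  ... | tri≈ _ σa≡σb _ rewrite σ-injective a b σa≡σb = ⊥-elim (<-irrefl refl lt)
  ... | tri> _ _ σb<σa = ⊥-elim (<-asym lt (preserves b a σb<σa))

contains-relocate : (w : Word n) (w′ : Word n′) {σ : Pattern m} (c : Contains w σ) (h : Fin m → Fin n′) →
                    (∀ a b → proj₁ c a <ᶠ proj₁ c b → h a <ᶠ h b) →
                    (∀ a → value w′ (h a) ≡ value w (proj₁ c a)) → Contains w′ σ
contains-relocate w w′ {σ} (f , inc , same-order) h h-order h-value =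
  h , (λ a b a<b → h-order a b (inc a b a<b)) ,
  λ a b → subst₂ (λ x y → (x < y) ⇔ (σ a < σ b)) (sym (h-value a)) (sym (h-value b)) (same-order a b)

p132-injective : PatternInjective p132
p132-injective = toWitness {a? = all? λ a → all? λ b → (p132 a ≟ p132 b) →-dec (a ≟ᶠ b)} _

p213-injective : PatternInjective p213
p213-injective = toWitness {a? = all? λ a → all? λ b → (p213 a ≟ p213 b) →-dec (a ≟ᶠ b)} _

triple : Fin n → Fin n → Fin n → Fin 3 → Fin n
triple a b c fzero = a
triple a b c (fsuc fzero) = b
triple a b c (fsuc (fsuc fzero)) = c

triple-increasing : {a b c : Fin n} → a <ᶠ b → b <ᶠ c → Increasing (triple a b c)
triple-increasing a<b b<c fzero (fsuc fzero) _ = a<b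
triple-increasing a<b b<c fzero (fsuc (fsuc fzero)) _ = <-trans a<b b<c
triple-increasing a<b b<c (fsuc fzero) (fsuc (fsuc fzero)) _ = b<c
triple-increasing a<b b<c (fsuc fzero) (fsuc fzero) (s≤s ())
triple-increasing a<b b<c (fsuc (fsuc fzero)) (fsuc fzero) (s≤s ())
triple-increasing a<b b<c (fsuc (fsuc fzero)) (fsuc (fsuc fzero)) (s≤s (s≤s ()))

contains-132 : (w : Word n) {a b c : Fin n} → a <ᶠ b → b <ᶠ c →
               value w a < value w c → value w c < value w b → Contains w p132
contains-132 w {a} {b} {c} a<b b<c wa<wc wc<wb =
  contains-by-order w p132-injective (triple a b c) (triple-increasing a<b b<c) preserves
  where
  preserves : ∀ x y → p132 x < p132 y → value w (triple a b c x) < value w (triple a b c y)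
  preserves fzero (fsuc fzero) _ = <-trans wa<wc wc<wb
  preserves fzero (fsuc (fsuc fzero)) _ = wa<wc
  preserves (fsuc (fsuc fzero)) (fsuc fzero) _ = wc<wb
  preserves fzero fzero (s≤s ())
  preserves (fsuc fzero) fzero (s≤s ())
  preserves (fsuc fzero) (fsuc fzero) (s≤s (s≤s (s≤s ())))
  preserves (fsuc fzero) (fsuc (fsuc fzero)) (s≤s (s≤s ()))
  preserves (fsuc (fsuc fzero)) fzero (s≤s ())
  preserves (fsuc (fsuc fzero)) (fsuc (fsuc fzero)) (s≤s (s≤s ()))

contains-213 : (w : Word n) {a b c : Fin n} → a <ᶠ b → b <ᶠ c →
               value w b < value w a → value w a < value w c → Contains w p213
contains-213 w {a} {b} {c} a<b b<c wb<wa wa<wc =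
  contains-by-order w p213-injective (triple a b c) (triple-increasing a<b b<c) preserves
  where
  preserves : ∀ x y → p213 x < p213 y → value w (triple a b c x) < value w (triple a b c y)
  preserves (fsuc fzero) fzero _ = wb<wa
  preserves fzero (fsuc (fsuc fzero)) _ = wa<wc
  preserves (fsuc fzero) (fsuc (fsuc fzero)) _ = <-trans wb<wa wa<wc
  preserves fzero fzero (s≤s (s≤s ()))
  preserves fzero (fsuc fzero) (s≤s ())
  preserves (fsuc fzero) (fsuc fzero) (s≤s ())
  preserves (fsuc (fsuc fzero)) fzero (s≤s (s≤s ()))
  preserves (fsuc (fsuc fzero)) (fsuc fzero) (s≤s ())
  preserves (fsuc (fsuc fzero)) (fsuc (fsuc fzero)) (s≤s (s≤s (s≤s ())))

-- Prepending the run of the largest values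

n∸i+j<n : ∀ {n i j} → j < i → j < n → n ∸ i + j < n
n∸i+j<n {n} {i} {j} j<i j<n with i ≤? n
... | yes i≤n = subst (n ∸ i + j <_) (m∸n+n≡m i≤n) (+-monoʳ-< (n ∸ i) j<i)
... | no  i≰n = subst (λ z → z + j < n) (sym (m≤n⇒m∸n≡0 (<⇒≤ (≰⇒> i≰n)))) j<n

suffixPosition : (i : ℕ) (j : Fin n) → i ≤ toℕ j → Fin (n ∸ i)
suffixPosition i j i≤j = fromℕ< (∸-monoˡ-< (toℕ<n j) i≤j)

toℕ-suffixPosition : ∀ i (j : Fin n) (i≤j : i ≤ toℕ j) → toℕ (suffixPosition i j i≤j) ≡ toℕ j ∸ i
toℕ-suffixPosition i j i≤j = toℕ-fromℕ< _

shiftPosition : (i : ℕ) → Fin (n ∸ i) → Fin n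
shiftPosition {n} i t = fromℕ< (m≤o∸n⇒m+n≤o (suc (toℕ t)) i≤n (toℕ<n t))
  where
  i≤n : i ≤ n
  i≤n = <⇒≤ (m∸n≢0⇒n<m (λ n∸i≡0 → ¬Fin0 (subst Fin n∸i≡0 t)))

toℕ-shiftPosition : ∀ i (t : Fin (n ∸ i)) → toℕ (shiftPosition i t) ≡ toℕ t + i
toℕ-shiftPosition i t = toℕ-fromℕ< _

shiftPosition-≥ : ∀ i (t : Fin (n ∸ i)) → i ≤ toℕ (shiftPosition i t)
shiftPosition-≥ i t = subst (i ≤_) (sym (toℕ-shiftPosition i t)) (m≤n+m i (toℕ t))

shiftPosition-suffixPosition : ∀ i (j : Fin n) (i≤j : i ≤ toℕ j) →
                               shiftPosition i (suffixPosition i j i≤j) ≡ j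
shiftPosition-suffixPosition i j i≤j = toℕ-injective (begin
  toℕ (shiftPosition i (suffixPosition i j i≤j)) ≡⟨ toℕ-shiftPosition i _ ⟩
  toℕ (suffixPosition i j i≤j) + i               ≡⟨ cong (_+ i) (toℕ-suffixPosition i j i≤j) ⟩
  toℕ j ∸ i + i                                  ≡⟨ m∸n+n≡m i≤j ⟩
  toℕ j                                          ∎)
  where open ≡-Reasoning

suffixPosition-shiftPosition : ∀ i (t : Fin (n ∸ i)) →
                               suffixPosition i (shiftPosition i t) (shiftPosition-≥ i t) ≡ t
suffixPosition-shiftPosition i t = toℕ-injective (begin
  toℕ (suffixPosition i (shiftPosition i t) (shiftPosition-≥ i t)) ≡⟨ toℕ-suffixPosition i _ (shiftPosition-≥ i t) ⟩
  toℕ (shiftPosition i t) ∸ i                                      ≡⟨ cong (_∸ i) (toℕ-shiftPosition i t) ⟩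
  toℕ t + i ∸ i                                                    ≡⟨ m+n∸n≡m (toℕ t) i ⟩
  toℕ t                                                            ∎)
  where open ≡-Reasoning

prependTop-entry : (i : ℕ) → Word (n ∸ i) → (j : Fin n) → Dec (toℕ j < i) → Fin n
prependTop-entry i u j (yes j<i) = fromℕ< (n∸i+j<n j<i (toℕ<n j))
prependTop-entry i u j (no  j≮i) = inject≤ (lookup u (suffixPosition i j (≮⇒≥ j≮i))) (m∸n≤m _ i)

-- The word whose first i entries are the i largest values n ∸ i, …, n ∸ 1 in increasing
-- order, followed by u.  For n ≤ i every entry lies in the prefix, and u is irrelevant.
prependTop : (i : ℕ) → Word (n ∸ i) → Word n
prependTop i u = tabulate λ j → prependTop-entry i u j (toℕ j <? i)

prependTop-prefix : ∀ i (u : Word (n ∸ i)) (j : Fin n) → toℕ j < i →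
                    value (prependTop i u) j ≡ n ∸ i + toℕ j
prependTop-prefix i u j j<i rewrite lookup∘tabulate (λ j → prependTop-entry i u j (toℕ j <? i)) j
  with toℕ j <? i
... | yes _   = toℕ-fromℕ< _
... | no  j≮i = contradiction j<i j≮i

prependTop-suffix : ∀ i (u : Word (n ∸ i)) (j : Fin n) (i≤j : i ≤ toℕ j) →
                    value (prependTop i u) j ≡ value u (suffixPosition i j i≤j)
prependTop-suffix i u j i≤j rewrite lookup∘tabulate (λ j → prependTop-entry i u j (toℕ j <? i)) j
  with toℕ j <? i
... | yes j<i = contradiction i≤j (<⇒≱ j<i)
... | no  _   = toℕ-inject≤ _ _

prependTop-shift : ∀ i (u : Word (n ∸ i)) (t : Fin (n ∸ i)) →
                   value (prependTop i u) (shiftPosition i t) ≡ value u t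
prependTop-shift i u t =
  trans (prependTop-suffix i u _ (shiftPosition-≥ i t)) (cong (value u) (suffixPosition-shiftPosition i t))

prependTop-prefix-≥ : ∀ i (u : Word (n ∸ i)) (j : Fin n) → toℕ j < i → n ∸ i ≤ value (prependTop i u) j
prependTop-prefix-≥ i u j j<i = subst (_ ≤_) (sym (prependTop-prefix i u j j<i)) (m≤m+n _ (toℕ j))

prependTop-suffix-< : ∀ i (u : Word (n ∸ i)) (j : Fin n) → i ≤ toℕ j → value (prependTop i u) j < n ∸ i
prependTop-suffix-< i u j i≤j = subst (_< _) (sym (prependTop-suffix i u j i≤j)) (toℕ<n _)

prependTop-prefix-increasing : ∀ i (u : Word (n ∸ i)) {a b : Fin n} → toℕ a < i → toℕ b < i →
                               a <ᶠ b → value (prependTop i u) a < value (prependTop i u) b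
prependTop-prefix-increasing {n} i u {a} {b} a<i b<i a<b
  rewrite prependTop-prefix i u a a<i | prependTop-prefix i u b b<i = +-monoʳ-< (n ∸ i) a<b

prependTop-above-prefix : ∀ i (u : Word (n ∸ i)) {a b : Fin n} → toℕ a < i →
                          value (prependTop i u) a < value (prependTop i u) b → toℕ b < i
prependTop-above-prefix i u {a} {b} a<i wa<wb with toℕ b <? i
... | yes b<i = b<i
... | no  b≮i = contradiction (<-≤-trans (prependTop-suffix-< i u b (≮⇒≥ b≮i)) (prependTop-prefix-≥ i u a a<i))
                              (<-asym wa<wb)

prependTop-isPerm : ∀ i {u : Word (n ∸ i)} → IsPerm u → IsPerm (prependTop i u)
prependTop-isPerm {n} i {u} u-perm a b wa≡wb with toℕ a <? i | toℕ b <? i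
... | yes a<i | yes b<i = toℕ-injective (+-cancelˡ-≡ (n ∸ i) _ _ (begin
  n ∸ i + toℕ a            ≡⟨ prependTop-prefix i u a a<i ⟨
  value (prependTop i u) a ≡⟨ cong toℕ wa≡wb ⟩
  value (prependTop i u) b ≡⟨ prependTop-prefix i u b b<i ⟩
  n ∸ i + toℕ b            ∎))
  where open ≡-Reasoning
... | yes a<i | no b≮i = contradiction (cong toℕ wa≡wb)
  (>⇒≢ (<-≤-trans (prependTop-suffix-< i u b (≮⇒≥ b≮i)) (prependTop-prefix-≥ i u a a<i)))
... | no a≮i | yes b<i = contradiction (cong toℕ wa≡wb)
  (<⇒≢ (<-≤-trans (prependTop-suffix-< i u a (≮⇒≥ a≮i)) (prependTop-prefix-≥ i u b b<i)))
... | no a≮i | no b≮i = begin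
  a                                                ≡⟨ shiftPosition-suffixPosition i a (≮⇒≥ a≮i) ⟨
  shiftPosition i (suffixPosition i a (≮⇒≥ a≮i))   ≡⟨ cong (shiftPosition i) same-suffix ⟩
  shiftPosition i (suffixPosition i b (≮⇒≥ b≮i))   ≡⟨ shiftPosition-suffixPosition i b (≮⇒≥ b≮i) ⟩
  b                                                ∎
  where
  open ≡-Reasoning
  same-suffix : suffixPosition i a (≮⇒≥ a≮i) ≡ suffixPosition i b (≮⇒≥ b≮i)
  same-suffix = value-injective u u-perm _ _ (begin
    value u (suffixPosition i a (≮⇒≥ a≮i)) ≡⟨ prependTop-suffix i u a (≮⇒≥ a≮i) ⟨
    value (prependTop i u) a               ≡⟨ cong toℕ wa≡wb ⟩
    value (prependTop i u) b               ≡⟨ prependTop-suffix i u b (≮⇒≥ b≮i) ⟩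
    value u (suffixPosition i b (≮⇒≥ b≮i)) ∎)

prependTop-injective : ∀ i {u u′ : Word (n ∸ i)} → prependTop i u ≡ prependTop i u′ → u ≡ u′
prependTop-injective i {u} {u′} eq = word-ext λ t → begin
  value u t                                   ≡⟨ prependTop-shift i u t ⟨
  value (prependTop i u) (shiftPosition i t)  ≡⟨ cong (λ w → value w (shiftPosition i t)) eq ⟩
  value (prependTop i u′) (shiftPosition i t) ≡⟨ prependTop-shift i u′ t ⟩
  value u′ t                                  ∎
  where open ≡-Reasoning

prependTop-head : ∀ i (u : Word (suc m ∸ i)) → 0 < i → value (prependTop i u) fzero ≡ suc m ∸ i
prependTop-head i u 0<i = trans (prependTop-prefix i u fzero 0<i) (+-identityʳ _)

prependTop-long : ∀ {i i′} (u : Word (n ∸ i)) (u′ : Word (n ∸ i′)) → n ≤ i → n ≤ i′ →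
                  prependTop i u ≡ prependTop i′ u′
prependTop-long {n} {i} {i′} u u′ n≤i n≤i′ = word-ext λ j → begin
  value (prependTop i u) j   ≡⟨ prependTop-prefix i u j (<-≤-trans (toℕ<n j) n≤i) ⟩
  n ∸ i + toℕ j              ≡⟨ cong (_+ toℕ j) (m≤n⇒m∸n≡0 n≤i) ⟩
  toℕ j                      ≡⟨ cong (_+ toℕ j) (m≤n⇒m∸n≡0 n≤i′) ⟨
  n ∸ i′ + toℕ j             ≡⟨ prependTop-prefix i′ u′ j (<-≤-trans (toℕ<n j) n≤i′) ⟨
  value (prependTop i′ u′) j ∎
  where open ≡-Reasoning

-- Positions of an occurrence increase, so one starting in the suffix stays there.
prependTop-contains-suffix : ∀ i (u : Word (n ∸ i)) {σ : Pattern (suc m)} (c : Contains (prependTop i u) σ) →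
                             i ≤ toℕ (proj₁ c fzero) → Contains u σ
prependTop-contains-suffix i u c@(f , inc , _) i≤f0 =
  contains-relocate (prependTop i u) u c (λ a → suffixPosition i (f a) (i≤f a)) order same-value
  where
  i≤f : ∀ a → i ≤ toℕ (f a)
  i≤f a = ≤-trans i≤f0 (increasing-least inc a)
  order : ∀ a b → f a <ᶠ f b → suffixPosition i (f a) (i≤f a) <ᶠ suffixPosition i (f b) (i≤f b)
  order a b fa<fb rewrite toℕ-suffixPosition i (f a) (i≤f a) | toℕ-suffixPosition i (f b) (i≤f b) =
    ∸-monoˡ-< fa<fb (i≤f a)
  same-value : ∀ a → value u (suffixPosition i (f a) (i≤f a)) ≡ value (prependTop i u) (f a)
  same-value a = sym (prependTop-suffix i u (f a) (i≤f a))

prependTop-avoids : ∀ i (u : Word (n ∸ i)) (σ : Pattern (suc m)) →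
                    (∀ (c : Contains (prependTop i u) σ) → toℕ (proj₁ c fzero) < i → ⊥) →
                    Avoids u σ → Avoids (prependTop i u) σ
prependTop-avoids i u σ no-prefix-start u-avoids c with toℕ (proj₁ c fzero) <? i
... | yes f0<i = no-prefix-start c f0<i
... | no  f0≮i = u-avoids (prependTop-contains-suffix i u c (≮⇒≥ f0≮i))

-- In the prefix, a larger value sits further right; this rules out the descents in 132 and 213.
prependTop-avoids-132 : ∀ i {u : Word (n ∸ i)} → Avoids u p132 → Avoids (prependTop i u) p132
prependTop-avoids-132 i {u} = prependTop-avoids i u p132 λ c a<i →
  let wa<wc = contains-< (prependTop i u) c fzero (fsuc (fsuc fzero)) (s≤s (s≤s z≤n))
      wc<wb = contains-< (prependTop i u) c (fsuc (fsuc fzero)) (fsuc fzero) (s≤s (s≤s (s≤s z≤n)))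
      c<i = prependTop-above-prefix i u a<i wa<wc
      b<i = prependTop-above-prefix i u a<i (<-trans wa<wc wc<wb)
      b<c = proj₁ (proj₂ c) (fsuc fzero) (fsuc (fsuc fzero)) (s≤s (s≤s z≤n))
  in <-asym wc<wb (prependTop-prefix-increasing i u b<i c<i b<c)

prependTop-avoids-213 : ∀ i {u : Word (n ∸ i)} → Avoids u p213 → Avoids (prependTop i u) p213
prependTop-avoids-213 i {u} = prependTop-avoids i u p213 λ c a<i →
  let inc = proj₁ (proj₂ c)
      wa<wc = contains-< (prependTop i u) c fzero (fsuc (fsuc fzero)) (s≤s (s≤s (s≤s z≤n)))
      wb<wa = contains-< (prependTop i u) c (fsuc fzero) fzero (s≤s (s≤s z≤n))
      c<i = prependTop-above-prefix i u a<i wa<wc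
      b<i = <-trans (inc (fsuc fzero) (fsuc (fsuc fzero)) (s≤s (s≤s z≤n))) c<i
  in <-asym wb<wa (prependTop-prefix-increasing i u a<i b<i (inc fzero (fsuc fzero) (s≤s z≤n)))

pCyc-rise : ∀ k (a : Fin k) → suc (toℕ a) ≢ k → pCyc k a ≡ suc (suc (toℕ a))
pCyc-rise k a a≢last with suc (toℕ a) ≟ k
... | yes a≡last = contradiction a≡last a≢last
... | no  _      = refl

pCyc-fall : ∀ k (a : Fin k) → suc (toℕ a) ≡ k → pCyc k a ≡ 1
pCyc-fall k a a≡last with suc (toℕ a) ≟ k
... | yes _      = refl
... | no  a≢last = contradiction a≡last a≢last

pCyc-injective : ∀ k → PatternInjective (pCyc k)
pCyc-injective k a b eq with suc (toℕ a) ≟ k | suc (toℕ b) ≟ k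
... | yes a≡last | yes b≡last = toℕ-injective (suc-injective (trans a≡last (sym b≡last)))
... | yes _      | no  _      = contradiction (suc-injective eq) 0≢1+n
... | no  _      | yes _      = contradiction (suc-injective (sym eq)) 0≢1+n
... | no  _      | no  _      = toℕ-injective (suc-injective (suc-injective eq))

cyc-first : ∀ r → pCyc (3 + r) fzero ≡ 2
cyc-first r = pCyc-rise (3 + r) fzero λ ()

cyc-peak : ∀ r → Fin (3 + r)
cyc-peak r = fromℕ< {suc r} (s≤s (s≤s (n≤1+n r)))

toℕ-cyc-peak : ∀ r → toℕ (cyc-peak r) ≡ suc r
toℕ-cyc-peak r = toℕ-fromℕ< (s≤s (s≤s (n≤1+n r)))

cyc-peak-value : ∀ r → pCyc (3 + r) (cyc-peak r) ≡ 3 + r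
cyc-peak-value r =
  trans (pCyc-rise (3 + r) (cyc-peak r) (λ eq → <-irrefl (trans (cong suc (sym (toℕ-cyc-peak r))) eq) (n<1+n _)))
        (cong (λ x → suc (suc x)) (toℕ-cyc-peak r))

cyc-last : ∀ r → Fin (3 + r)
cyc-last r = fromℕ (2 + r)

cyc-last-value : ∀ r → pCyc (3 + r) (cyc-last r) ≡ 1
cyc-last-value r = pCyc-fall (3 + r) (cyc-last r) (cong suc (toℕ-fromℕ (2 + r)))

-- With a prefix of length at most 1 + r an occurrence starting in the prefix has no room
-- for its peak, which must also lie in the prefix; a prefix covering the whole word is increasing.
prependTop-avoids-cyc : ∀ r i {u : Word (n ∸ i)} → i ≤ suc r ⊎ n ≤ i →
                        Avoids u (pCyc (3 + r)) → Avoids (prependTop i u) (pCyc (3 + r))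
prependTop-avoids-cyc {n} r i {u} short-or-full =
  prependTop-avoids i u (pCyc (3 + r)) (no-prefix-start short-or-full)
  where
  no-prefix-start : i ≤ suc r ⊎ n ≤ i →
                    ∀ (c : Contains (prependTop i u) (pCyc (3 + r))) → toℕ (proj₁ c fzero) < i → ⊥
  no-prefix-start (inj₁ i≤1+r) c@(f , inc , _) f0<i = <⇒≱ peak<i (≤-trans i≤1+r 1+r≤peak)
    where
    peak<i : toℕ (f (cyc-peak r)) < i
    peak<i = prependTop-above-prefix i u f0<i (contains-< (prependTop i u) c fzero (cyc-peak r)
               (subst₂ _<_ (sym (cyc-first r)) (sym (cyc-peak-value r)) (s≤s (s≤s (s≤s z≤n)))))
    1+r≤peak : suc r ≤ toℕ (f (cyc-peak r))
    1+r≤peak = subst (_≤ toℕ (f (cyc-peak r))) (toℕ-cyc-peak r) (increasing⇒≥id inc (cyc-peak r))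
  no-prefix-start (inj₂ n≤i) c@(f , inc , _) f0<i = <-asym last<first (first<last)
    where
    last<first : value (prependTop i u) (f (cyc-last r)) < value (prependTop i u) (f fzero)
    last<first = contains-< (prependTop i u) c (cyc-last r) fzero
                   (subst₂ _<_ (sym (cyc-last-value r)) (sym (cyc-first r)) (s≤s (s≤s z≤n)))
    first<last : value (prependTop i u) (f fzero) < value (prependTop i u) (f (cyc-last r))
    first<last = prependTop-prefix-increasing i u f0<i (<-≤-trans (toℕ<n _) n≤i)
                   (inc fzero (cyc-last r) (subst (0 <_) (sym (toℕ-fromℕ (2 + r))) (s≤s z≤n)))

-- The first 2 + r prefix entries rise, and the first suffix entry lies below all of them.
prependTop-contains-cyc : ∀ r i (u : Word (n ∸ i)) → 2 + r ≤ i → i < n →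
                          Contains (prependTop i u) (pCyc (3 + r))
prependTop-contains-cyc {n} r i u 2+r≤i i<n =
  contains-by-order (prependTop i u) (pCyc-injective (3 + r)) f increasing preserves
  where
  w = prependTop i u
  rising<i : (a : Fin (3 + r)) → suc (toℕ a) ≢ 3 + r → toℕ a < i
  rising<i a a≢last = <-≤-trans (≤∧≢⇒< (≤-pred (toℕ<n a)) (λ eq → a≢last (cong suc eq))) 2+r≤i
  position : (a : Fin (3 + r)) → Dec (suc (toℕ a) ≡ 3 + r) → Fin n
  position a (yes _)      = fromℕ< i<n
  position a (no a≢last)  = fromℕ< (<-trans (rising<i a a≢last) i<n)
  f : Fin (3 + r) → Fin n
  f a = position a (suc (toℕ a) ≟ 3 + r)
  rising-value : ∀ a a≢last → value w (position a (no a≢last)) ≡ n ∸ i + toℕ a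
  rising-value a a≢last = trans (prependTop-prefix i u _ (subst (_< i) (sym (toℕ-fromℕ< _)) (rising<i a a≢last)))
                                (cong (n ∸ i +_) (toℕ-fromℕ< _))
  falling-value : ∀ a a≡last → value w (position a (yes a≡last)) < n ∸ i
  falling-value a a≡last = prependTop-suffix-< i u _ (subst (i ≤_) (sym (toℕ-fromℕ< i<n)) ≤-refl)
  increasing : Increasing f
  increasing a b a<b with suc (toℕ a) ≟ 3 + r | suc (toℕ b) ≟ 3 + r
  ... | yes a≡last | _          =
    contradiction (<-≤-trans (s≤s a<b) (subst (suc (toℕ b) ≤_) (sym a≡last) (toℕ<n b))) (<-irrefl refl)
  ... | no a≢last  | yes _      = subst₂ _<_ (sym (toℕ-fromℕ< _)) (sym (toℕ-fromℕ< i<n)) (rising<i a a≢last)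
  ... | no _       | no _       = subst₂ _<_ (sym (toℕ-fromℕ< _)) (sym (toℕ-fromℕ< _)) a<b
  preserves : ∀ a b → pCyc (3 + r) a < pCyc (3 + r) b → value w (f a) < value w (f b)
  preserves a b lt with suc (toℕ a) ≟ 3 + r | suc (toℕ b) ≟ 3 + r
  ... | yes _      | yes _      = contradiction lt (<-irrefl refl)
  ... | yes a≡last | no b≢last  = subst (_ <_) (sym (rising-value b b≢last))
                                        (<-≤-trans (falling-value a a≡last) (m≤m+n (n ∸ i) (toℕ b)))
  ... | no _       | yes _      = contradiction lt λ { (s≤s ()) }
  ... | no a≢last  | no b≢last  = subst₂ _<_ (sym (rising-value a a≢last)) (sym (rising-value b b≢last))
                                        (+-monoʳ-< (n ∸ i) (≤-pred (≤-pred lt)))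

suffixWord : (w : Word n) (i : ℕ) → (∀ j → i ≤ toℕ j → value w j < n ∸ i) → Word (n ∸ i)
suffixWord w i below = tabulate λ t → fromℕ< (below (shiftPosition i t) (shiftPosition-≥ i t))

value-suffixWord : ∀ (w : Word n) i below (t : Fin (n ∸ i)) →
                   value (suffixWord w i below) t ≡ value w (shiftPosition i t)
value-suffixWord w i below t = trans (cong toℕ (lookup∘tabulate _ t)) (toℕ-fromℕ< _)

prependTop-suffixWord : ∀ (w : Word n) i below → (∀ j → toℕ j < i → value w j ≡ n ∸ i + toℕ j) →
                        prependTop i (suffixWord w i below) ≡ w
prependTop-suffixWord w i below prefix = word-ext same-value
  where
  same-value : ∀ j → value (prependTop i (suffixWord w i below)) j ≡ value w j
  same-value j with toℕ j <? i
  ... | yes j<i = trans (prependTop-prefix i _ j j<i) (sym (prefix j j<i))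
  ... | no  j≮i = begin
    value (prependTop i (suffixWord w i below)) j          ≡⟨ prependTop-suffix i _ j i≤j ⟩
    value (suffixWord w i below) (suffixPosition i j i≤j)  ≡⟨ value-suffixWord w i below _ ⟩
    value w (shiftPosition i (suffixPosition i j i≤j))     ≡⟨ cong (value w) (shiftPosition-suffixPosition i j i≤j) ⟩
    value w j                                              ∎
    where
    open ≡-Reasoning
    i≤j = ≮⇒≥ j≮i

shiftPosition-injective : ∀ i {s t : Fin (n ∸ i)} → shiftPosition i s ≡ shiftPosition i t → s ≡ t
shiftPosition-injective i {s} {t} eq = toℕ-injective (+-cancelʳ-≡ i _ _ (begin
  toℕ s + i                 ≡⟨ toℕ-shiftPosition i s ⟨
  toℕ (shiftPosition i s)   ≡⟨ cong toℕ eq ⟩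
  toℕ (shiftPosition i t)   ≡⟨ toℕ-shiftPosition i t ⟩
  toℕ t + i                 ∎))
  where open ≡-Reasoning

suffixWord-isPerm : ∀ (w : Word n) i below → IsPerm w → IsPerm (suffixWord w i below)
suffixWord-isPerm w i below w-perm s t eq = shiftPosition-injective i (value-injective w w-perm _ _ (begin
  value w (shiftPosition i s)     ≡⟨ value-suffixWord w i below s ⟨
  value (suffixWord w i below) s  ≡⟨ cong toℕ eq ⟩
  value (suffixWord w i below) t  ≡⟨ value-suffixWord w i below t ⟩
  value w (shiftPosition i t)     ∎))
  where open ≡-Reasoning

suffixWord-avoids : ∀ (w : Word n) i below {σ : Pattern m} → Avoids w σ → Avoids (suffixWord w i below) σ
suffixWord-avoids w i below w-avoids c@(f , _ , _) =
  w-avoids (contains-relocate (suffixWord w i below) w c (shiftPosition i ∘ f) order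
                              (λ a → sym (value-suffixWord w i below (f a))))
  where
  order : ∀ a b → f a <ᶠ f b → shiftPosition i (f a) <ᶠ shiftPosition i (f b)
  order a b fa<fb =
    subst₂ _<_ (sym (toℕ-shiftPosition i (f a))) (sym (toℕ-shiftPosition i (f b))) (+-monoˡ-< i fa<fb)

prependTop-injectiveˡ : ∀ {i i′} (u : Word (n ∸ i)) (u′ : Word (n ∸ i′)) → 0 < i → 0 < i′ →
                        i ≤ n → i′ ≤ n → prependTop i u ≡ prependTop i′ u′ → i ≡ i′
prependTop-injectiveˡ {suc m} {i} {i′} u u′ 0<i 0<i′ i≤n i′≤n eq = ∸-cancelˡ-≡ i≤n i′≤n (begin
  suc m ∸ i                        ≡⟨ prependTop-head i u 0<i ⟨
  value (prependTop i u) fzero     ≡⟨ cong (λ w → value w fzero) eq ⟩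
  value (prependTop i′ u′) fzero   ≡⟨ prependTop-head i′ u′ 0<i′ ⟩
  suc m ∸ i′                       ∎)
  where open ≡-Reasoning
prependTop-injectiveˡ {zero} u u′ 0<i _ i≤0 _ _ = contradiction (<-≤-trans 0<i i≤0) λ ()

-- Structure of permutations avoiding 132 and 213

module _ {m : ℕ} (w : Word (suc m)) (w-perm : IsPerm w) where

  private
    v = value w fzero

  run-position : ∀ b t → (∀ s → toℕ s < b → value w s ≡ v + toℕ s) →
                 v ≤ value w t → value w t < v + b → toℕ t ≡ value w t ∸ v
  run-position b t run v≤wt wt<v+b = begin
    toℕ t         ≡⟨ cong toℕ (value-injective w w-perm s t ws≡wt) ⟨
    toℕ s         ≡⟨ toℕ-fromℕ< _ ⟩
    value w t ∸ v ∎
    where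
    open ≡-Reasoning
    s : Fin (suc m)
    s = fromℕ< (≤-<-trans (m∸n≤m (value w t) v) (toℕ<n (lookup w t)))
    s<b : toℕ s < b
    s<b = subst₂ _<_ (sym (toℕ-fromℕ< _)) (m+n∸m≡n v b) (∸-monoˡ-< wt<v+b v≤wt)
    ws≡wt : value w s ≡ value w t
    ws≡wt = trans (run s s<b) (trans (cong (v +_) (toℕ-fromℕ< _)) (m+[n∸m]≡n v≤wt))

  value-position : ∀ x → x < suc m → ∃ λ p → value w p ≡ x
  value-position x x<n with p , wp≡x ← IsPerm-surjective w w-perm (fromℕ< x<n) =
    p , trans (cong toℕ wp≡x) (toℕ-fromℕ< x<n)

  module _ (avoids-132 : Avoids w p132) (avoids-213 : Avoids w p213) where

    -- Let p be the position of v + t. Below v, w t would form a 213 at 0, t, p; in [v, v + t)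
    -- it would repeat a value of the run; above v + t it would form a 132 at t - 1, t, p.
    head-run-step : ∀ t → (∀ {s} → s <ᶠ t → toℕ s < suc m ∸ v → value w s ≡ v + toℕ s) →
                    toℕ t < suc m ∸ v → value w t ≡ v + toℕ t
    head-run-step fzero _ _ = sym (+-identityʳ v)
    head-run-step t@(fsuc t′) run t<n∸v = settle (<-cmp (value w t) y)
      where
      y = v + toℕ t
      earlier : ∀ s → s <ᶠ t → value w s ≡ v + toℕ s
      earlier s s<t = run s<t (<-trans s<t t<n∸v)
      y<n : y < suc m
      y<n = subst (y <_) (m+[n∸m]≡n (<⇒≤ (toℕ<n (lookup w fzero)))) (+-monoʳ-< v t<n∸v)
      p : Fin (suc m)
      p = proj₁ (value-position y y<n)
      wp≡y : value w p ≡ y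
      wp≡y = proj₂ (value-position y y<n)
      t<p : value w t ≢ y → t <ᶠ p
      t<p wt≢y with <-cmp (toℕ p) (toℕ t)
      ... | tri< p<t _ _ = contradiction (trans (sym (earlier p p<t)) wp≡y) (<⇒≢ (+-monoʳ-< v p<t))
      ... | tri≈ _ p≡t _ = contradiction (trans (cong (value w) (toℕ-injective (sym p≡t))) wp≡y) wt≢y
      ... | tri> _ _ t<p = t<p
      prev : Fin (suc m)
      prev = inject₁ t′
      prev<t : prev <ᶠ t
      prev<t = subst (_< toℕ t) (sym (toℕ-inject₁ t′)) ≤-refl
      settle : Tri (value w t < y) (value w t ≡ y) (y < value w t) → value w t ≡ y
      settle (tri≈ _ wt≡y _) = wt≡y
      settle (tri< wt<y _ _) with value w t <? v
      ... | yes wt<v = ⊥-elim (avoids-213 (contains-213 w (s≤s z≤n) (t<p (<⇒≢ wt<y)) wt<v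
                         (subst (v <_) (sym wp≡y) (m<m+n v (s≤s z≤n)))))
      ... | no  wt≮v = ⊥-elim (<-irrefl (sym (run-position (toℕ t) t earlier (≮⇒≥ wt≮v) wt<y))
                         (subst (value w t ∸ v <_) (m+n∸m≡n v (toℕ t)) (∸-monoˡ-< wt<y (≮⇒≥ wt≮v))))
      settle (tri> _ _ y<wt) = ⊥-elim (avoids-132 (contains-132 w prev<t (t<p (>⇒≢ y<wt))
                                 (subst₂ _<_ (sym (earlier prev prev<t)) (sym wp≡y) (+-monoʳ-< v prev<t))
                                 (subst (_< value w t) (sym wp≡y) y<wt)))

    head-run : ∀ t → toℕ t < suc m ∸ v → value w t ≡ v + toℕ t
    head-run = All.wfRec <-wellFounded _ _ head-run-step

    tail-below : ∀ t → suc m ∸ v ≤ toℕ t → value w t < v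
    tail-below t n∸v≤t with value w t <? v
    ... | yes wt<v = wt<v
    ... | no  wt≮v = contradiction (subst (_< suc m ∸ v) (sym t≡wt∸v) (∸-monoˡ-< (toℕ<n (lookup w t)) (≮⇒≥ wt≮v)))
                                   (≤⇒≯ n∸v≤t)
      where
      t≡wt∸v : toℕ t ≡ value w t ∸ v
      t≡wt∸v = run-position (suc m ∸ v) t head-run (≮⇒≥ wt≮v)
                 (subst (value w t <_) (sym (m+[n∸m]≡n (<⇒≤ (toℕ<n (lookup w fzero))))) (toℕ<n (lookup w t)))

    private
      n∸[n∸v]≡v : suc m ∸ (suc m ∸ v) ≡ v
      n∸[n∸v]≡v = m∸[m∸n]≡n (<⇒≤ (toℕ<n (lookup w fzero)))

    tail-below-top : ∀ t → suc m ∸ v ≤ toℕ t → value w t < suc m ∸ (suc m ∸ v)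
    tail-below-top t n∸v≤t = subst (value w t <_) (sym n∸[n∸v]≡v) (tail-below t n∸v≤t)

    prependTop-tail : prependTop (suc m ∸ v) (suffixWord w (suc m ∸ v) tail-below-top) ≡ w
    prependTop-tail = prependTop-suffixWord w (suc m ∸ v) tail-below-top
      λ j j<n∸v → trans (head-run j j<n∸v) (cong (_+ toℕ j) (sym n∸[n∸v]≡v))

Decomposition : (r n j : ℕ) → Word n → Set
Decomposition r n j w = ∃ λ i → 1 ≤ i × i ≤ j × ∃ λ u → InS (3 + r) (n ∸ i) u × prependTop i u ≡ w

InS-decomposition : ∀ r {n} (w : Word n) → 0 < n → InS (3 + r) n w →
                    ∃ λ i → 1 ≤ i × (i ≤ suc r ⊎ n ≤ i) × ∃ λ u → InS (3 + r) (n ∸ i) u × prependTop i u ≡ w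
InS-decomposition r {suc m} w _ (w-perm , avoids-132 , avoids-213 , avoids-cyc) =
  i , m<n⇒0<n∸m v<n , bound (v ≟ 0) ,
  u , (suffixWord-isPerm w i below w-perm , suffixWord-avoids w i below avoids-132 ,
       suffixWord-avoids w i below avoids-213 , suffixWord-avoids w i below avoids-cyc) ,
  u-decomposes-w
  where
  v = value w fzero
  v<n : v < suc m
  v<n = toℕ<n (lookup w fzero)
  i = suc m ∸ v
  below = tail-below-top w w-perm avoids-132 avoids-213
  u = suffixWord w i below
  u-decomposes-w : prependTop i u ≡ w
  u-decomposes-w = prependTop-tail w w-perm avoids-132 avoids-213
  bound : Dec (v ≡ 0) → i ≤ suc r ⊎ suc m ≤ i
  bound (yes v≡0) = inj₂ (subst (λ x → suc m ≤ suc m ∸ x) (sym v≡0) ≤-refl)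
  bound (no  v≢0) with i ≤? suc r
  ... | yes i≤1+r = inj₁ i≤1+r
  ... | no  i≰1+r = ⊥-elim (avoids-cyc (subst (λ x → Contains x (pCyc (3 + r))) u-decomposes-w
                             (prependTop-contains-cyc r i u (≰⇒> i≰1+r) (∸-monoʳ-< (n≢0⇒n>0 v≢0) (<⇒≤ v<n)))))

-- Counting

InS-empty : ∀ r {n} → n ≡ 0 → (u : Word n) → InS (3 + r) n u
InS-empty r refl u = (λ ()) , no-occurrence , no-occurrence , no-occurrence
  where
  no-occurrence : ∀ {k} {σ : Pattern (suc k)} → Avoids u σ
  no-occurrence c = ¬Fin0 (proj₁ c fzero)

InS-prependTop : ∀ r {n} i (u : Word (n ∸ i)) → i ≤ suc r ⊎ n ≤ i →
                 InS (3 + r) (n ∸ i) u → InS (3 + r) n (prependTop i u)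
InS-prependTop r i u short-or-full (u-perm , avoids-132 , avoids-213 , avoids-cyc) =
  prependTop-isPerm i u-perm , prependTop-avoids-132 i avoids-132 , prependTop-avoids-213 i avoids-213 ,
  prependTop-avoids-cyc r i short-or-full avoids-cyc

emptySuffix : ∀ n → Word (n ∸ n)
emptySuffix n = subst Word (sym (n∸n≡0 n)) []

identityWord : (n : ℕ) → Word n
identityWord n = prependTop n (emptySuffix n)

InS-identityWord : ∀ r n → InS (3 + r) n (identityWord n)
InS-identityWord r n = InS-prependTop r n (emptySuffix n) (inj₂ ≤-refl) (InS-empty r (n∸n≡0 n) (emptySuffix n))

module Counting (r : ℕ) (card : ℕ → ℕ) (count : ∀ n → IsCount (3 + r) n (card n)) (n : ℕ) where

  enumeration : ∀ i → List (Word (n ∸ i))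
  enumeration i = proj₁ (count (n ∸ i))

  layer : ∀ i → List (Word n)
  layer i = map (prependTop i) (enumeration i)

  length-layer : ∀ i → length (layer i) ≡ card (n ∸ i)
  length-layer i = trans (length-map (prependTop i) (enumeration i)) (proj₁ (proj₂ (count (n ∸ i))))

  decompositions : ℕ → List (Word n)
  decompositions zero    = []
  decompositions (suc j) = decompositions j ++ layer (suc j)

  length-decompositions : ∀ j → length (decompositions j) ≡ sumFrom1 j (λ i → card (n ∸ i))
  length-decompositions zero    = refl
  length-decompositions (suc j) =
    trans (length-++ (decompositions j)) (cong₂ _+_ (length-decompositions j) (length-layer (suc j)))

  decompositions-enumerates : ∀ j → j < n → Enumerates (Decomposition r n j) (decompositions j)
  decompositions-enumerates zero    _   =
    [] , λ w → mk⇔ (λ ()) λ { (i , 1≤i , i≤0 , _) → ⊥-elim (<-irrefl refl (<-≤-trans 1≤i i≤0)) }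
  decompositions-enumerates (suc j) j<n =
    enumerates-cong split
      (enumerates-++ (decompositions-enumerates j (<-trans (n<1+n j) j<n))
                     (enumerates-map (prependTop (suc j)) (prependTop-injective (suc j))
                                     (proj₂ (proj₂ (count (n ∸ suc j)))))
                     disjoint)
    where
    New : Word n → Set
    New w = ∃ λ u → InS (3 + r) (n ∸ suc j) u × prependTop (suc j) u ≡ w
    disjoint : ∀ w → Decomposition r n j w → New w → ⊥
    disjoint w (i , 1≤i , i≤j , u , _ , refl) (u′ , _ , eq) =
      <-irrefl (prependTop-injectiveˡ u u′ 1≤i (s≤s z≤n) (≤-trans i≤j (<⇒≤ (<-trans (n<1+n j) j<n))) (<⇒≤ j<n) (sym eq))
               (s≤s i≤j)
    split : ∀ w → (Decomposition r n j w ⊎ New w) ⇔ Decomposition r n (suc j) w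
    split w = mk⇔ (λ { (inj₁ (i , 1≤i , i≤j , rest)) → i , 1≤i , m≤n⇒m≤1+n i≤j , rest
                     ; (inj₂ new) → suc j , s≤s z≤n , ≤-refl , new })
                  λ { (i , 1≤i , i≤1+j , rest) → widen i 1≤i rest (m≤n⇒m<n∨m≡n i≤1+j) }
      where
      widen : ∀ i → 1 ≤ i → (∃ λ u → InS (3 + r) (n ∸ i) u × prependTop i u ≡ w) →
              i < suc j ⊎ i ≡ suc j → Decomposition r n j w ⊎ New w
      widen i 1≤i rest (inj₁ i<1+j) = inj₁ (i , 1≤i , ≤-pred i<1+j , rest)
      widen i 1≤i rest (inj₂ refl)  = inj₂ rest

  InS-split : 2 + r ≤ n → ∀ w → (w ≡ identityWord n ⊎ Decomposition r n (suc r) w) ⇔ InS (3 + r) n w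
  InS-split 2+r≤n w = mk⇔ sound complete
    where
    sound : w ≡ identityWord n ⊎ Decomposition r n (suc r) w → InS (3 + r) n w
    sound (inj₁ refl) = InS-identityWord r n
    sound (inj₂ (i , _ , i≤1+r , u , u-in , refl)) = InS-prependTop r i u (inj₁ i≤1+r) u-in
    complete : InS (3 + r) n w → w ≡ identityWord n ⊎ Decomposition r n (suc r) w
    complete w-in with InS-decomposition r w (<-≤-trans (s≤s z≤n) 2+r≤n) w-in
    ... | i , 1≤i , inj₁ i≤1+r , rest          = inj₂ (i , 1≤i , i≤1+r , rest)
    ... | i , _   , inj₂ n≤i   , u , _ , refl  = inj₁ (prependTop-long u (emptySuffix n) n≤i ≤-refl)

  identityWord-not-decomposition : 2 + r ≤ n → ¬ Decomposition r n (suc r) (identityWord n)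
  identityWord-not-decomposition 2+r≤n (i , 1≤i , i≤1+r , u , _ , eq) =
    <-irrefl (prependTop-injectiveˡ u (emptySuffix n) 1≤i (<-≤-trans (s≤s z≤n) 2+r≤n)
                                    (≤-trans i≤1+r (<⇒≤ 2+r≤n)) ≤-refl eq)
             (≤-<-trans i≤1+r 2+r≤n)

  recurrence : 2 + r ≤ n → card n ≡ 1 + sumFrom1 (suc r) (λ i → card (n ∸ i))
  recurrence 2+r≤n = begin
    card n
      ≡⟨ proj₁ (proj₂ (count n)) ⟨
    length (proj₁ (count n))
      ≡⟨ enumerates-length (proj₂ (proj₂ (count n))) identity-and-decompositions ⟩
    length (identityWord n ∷ decompositions (suc r))
      ≡⟨ cong suc (length-decompositions (suc r)) ⟩
    1 + sumFrom1 (suc r) (λ i → card (n ∸ i))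
      ∎
    where
    open ≡-Reasoning
    identity-and-decompositions : Enumerates (InS (3 + r) n) (identityWord n ∷ decompositions (suc r))
    identity-and-decompositions =
      enumerates-cong (InS-split 2+r≤n)
        (enumerates-++ enumerates-[ identityWord n ] (decompositions-enumerates (suc r) 2+r≤n)
                       λ { w refl → identityWord-not-decomposition 2+r≤n })

proposition5p5 : (k : ℕ) → 3 ≤ k →
    (card : ℕ → ℕ) → (∀ m → IsCount k m (card m)) →
    ∀ (n : ℕ) → k ∸ 1 ≤ n →
    card n ≡ 1 + sumFrom1 (k ∸ 2) (λ i → card (n ∸ i))
proposition5p5 (suc (suc (suc r))) _ card count n k∸1≤n = Counting.recurrence r card count n k∸1≤n
proposition5p5 (suc (suc zero)) (s≤s (s≤s ()))
proposition5p5 (suc zero) (s≤s ())
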